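{- Let $T$ be a trigraph in the class $\mathcal F$ such that $T$ is either the complement of a bipartite trigraph or the complement of a line trigraph. If $T$ is favorable, then either $T$ is a graph (has no switchable pair), or $T$ has an even pair disjoint from its switchable component.
   Context: A trigraph $T$ consists of a finite set $V(T)$ and a map $\theta:\binom{V(T)}{2}\to\{ -1,0,1\}$. Distinct $u,v$ are strongly adjacent if $\theta(uv)=1$, strongly antiadjacent if $\theta(uv)=-1$, semiadjacent (a switchable pair) if $\theta(uv)=0$; adjacent if $\theta(uv)\in\{0,1\}$, antiadjacent if $\theta(uv)\in\{0,-1\}$. $N(v)$ is the set of vertices adjacent to $v$. The complement $\overline T$ has adjacency $-\theta$. $T|X$ is the restriction to $X$, $T\setminus X=T|(V(T)\setminus X)$. A clique (strong clique) is a set of pairwise adjacent (strongly adjacent) vertices; a strongly stable set is a set of pairwise strongly antiadjacent vertices. The full realization is the graph whose edges are the adjacent pairs. $T$ is bipartite if $V(T)$ can be partitioned into two strongly stable sets; $T$ is a line trigraph if its full realization is the line graph of a bipartite graph and every clique of size at least $3$ is a strong clique. A path is a sequence $p_1,\dots,p_k$ of distinct vertices with $p_i,p_j$ adjacent when $|i-j|=1$ and antiadjacent when $|i-j|>1$; length $k-1$. A hole is a sequence $h_1,\dots,h_k$ ($k\ge5$) with cyclically consecutive vertices adjacent and other pairs antiadjacent; an antihole is an induced subtrigraph whose complement is a hole. $T$ is Berge if it has no odd hole and no odd antihole. An even pair is a strongly antiadjacent pair $\{u,v\}$ such that every path from $u$ to $v$ has even length. $\Sigma(T)$ is the graph on $V(T)$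 whose edges are the switchable pairs; a switchable component is a component of $\Sigma(T)$ with at least two vertices. $\mathcal F$ is the class of Berge trigraphs with at most one switchable component, having at most two edges, such that if it has one edge $xy$ then $N(x)\cap N(y)=\emptyset$ (small), and if it has two edges $vx,vy$ then $v$ is strongly antiadjacent to all vertices outside $\{v,x,y\}$, $x,y$ are strongly antiadjacent and $N(x)\cap N(y)=\{v\}$ (light). $D$ denotes the vertex set of the switchable component ($\emptyset$ if none); a pair is disjoint from the switchable component if it does not meet $D$. $T\in\mathcal F$ is favorable if $|V(T)|\ge5$, $T$ has a strongly antiadjacent pair disjoint from $D$, and, if $D=\{x,y\}$ is small, at least one of $T\setminus(D\cup N(x))$, $T\setminus(D\cup N(y))$ is not a clique. -}

module Defs where

open import Data.Nat using (ℕ; zero; suc; _≤_; _<_)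
open import Data.Nat.Divisibility using (_∣_)
open import Data.Fin using (Fin; toℕ; fromℕ)
open import Data.Fin.Subset using (Subset; _∈_; ∣_∣)
open import Data.Product using (Σ; ∃; ∃-syntax; _×_; _,_)
open import Data.Sum using (_⊎_)
open import Relation.Nullary using (¬_)
open import Relation.Binary.PropositionalEquality using (_≡_; _≢_; cong)
open import Function.Definitions using (Injective)

-- values of θ : plus = 1 (strongly adjacent), zero = 0 (semiadjacent), minus = -1
data Val : Set where
  plus  : Val
  semi  : Val
  minus : Val

neg : Val → Val
neg plus  = minus
neg semi  = semi
neg minus = plus

-- A trigraph on vertex set Fin n.  θ is only meaningful on distinct pairs;
-- every notion below requires distinctness explicitly.
record Trigraph (n : ℕ) : Set where
  field
    θ   : Fin n → Fin n → Val
    sym : ∀ u v → θ u v ≡ θ v u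
open Trigraph public

complement : ∀ {n} → Trigraph n → Trigraph n
complement T = record { θ = λ u v → neg (θ T u v) ; sym = λ u v → cong neg (sym T u v) }

module _ {n : ℕ} (T : Trigraph n) where

  StrongAdj : Fin n → Fin n → Set
  StrongAdj u v = u ≢ v × θ T u v ≡ plus

  StrongAnti : Fin n → Fin n → Set
  StrongAnti u v = u ≢ v × θ T u v ≡ minus

  Semiadj : Fin n → Fin n → Set
  Semiadj u v = u ≢ v × θ T u v ≡ semi

  Adj : Fin n → Fin n → Set
  Adj u v = u ≢ v × θ T u v ≢ minus

  Anti : Fin n → Fin n → Set
  Anti u v = u ≢ v × θ T u v ≢ plus

  record Path (u v : Fin n) (k : ℕ) : Set where
    field
      p        : Fin (suc k) → Fin n
      inj      : Injective _≡_ _≡_ p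
      start    : p Fin.zero ≡ u
      end      : p (fromℕ k) ≡ v
      consec   : ∀ i j → suc (toℕ i) ≡ toℕ j → Adj (p i) (p j)
      nonconsec : ∀ i j → suc (toℕ i) < toℕ j → Anti (p i) (p j)

  CycSucc : (k : ℕ) → Fin k → Fin k → Set
  CycSucc k i j = suc (toℕ i) ≡ toℕ j ⊎ (suc (toℕ i) ≡ k × toℕ j ≡ 0)

  record Hole (k : ℕ) : Set where
    field
      five     : 5 ≤ k
      h        : Fin k → Fin n
      inj      : Injective _≡_ _≡_ h
      consec   : ∀ i j → CycSucc k i j → Adj (h i) (h j)
      nonconsec : ∀ i j → i ≢ j → ¬ CycSucc k i j → ¬ CycSucc k j i → Anti (h i) (h j)

  HasOddHole : Set
  HasOddHole = ∃[ k ] (Hole k × ¬ (2 ∣ k))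

  IsBipartite : Set
  IsBipartite = Σ (Fin n → Fin 2) λ side →
    ∀ u v → u ≢ v → side u ≡ side v → StrongAnti u v

  -- full realization is the line graph of a bipartite graph H, where H has
  -- sides Fin a and Fin b, and vertex v of T is the edge e v = (left, right) of H
  -- (e injective, so H is simple and E(H) is in bijection with V(T)).
  FullRealizationIsLineGraphOfBipartite : Set
  FullRealizationIsLineGraphOfBipartite =
    Σ ℕ λ a → Σ ℕ λ b → Σ (Fin n → Fin a × Fin b) λ e →
      Injective _≡_ _≡_ e ×
      (∀ u v → u ≢ v →
         (Adj u v → (Data.Product.proj₁ (e u) ≡ Data.Product.proj₁ (e v)
                    ⊎ Data.Product.proj₂ (e u) ≡ Data.Product.proj₂ (e v)))
       × ((Data.Product.proj₁ (e u) ≡ Data.Product.proj₁ (e v)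
                    ⊎ Data.Product.proj₂ (e u) ≡ Data.Product.proj₂ (e v)) → Adj u v))

  IsCliqueSet : Subset n → Set
  IsCliqueSet X = ∀ u v → u ∈ X → v ∈ X → u ≢ v → Adj u v

  IsStrongCliqueSet : Subset n → Set
  IsStrongCliqueSet X = ∀ u v → u ∈ X → v ∈ X → u ≢ v → StrongAdj u v

  IsLineTrigraph : Set
  IsLineTrigraph = FullRealizationIsLineGraphOfBipartite ×
    (∀ (X : Subset n) → 3 ≤ ∣ X ∣ → IsCliqueSet X → IsStrongCliqueSet X)

  InN : Fin n → Fin n → Set
  InN y w = Adj y w

  -- D : vertex set of the switchable component(s) = vertices in some switchable pair
  InD : Fin n → Set
  InD w = ∃[ u ] Semiadj w u

  SmallComponent : Fin n → Fin n → Set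
  SmallComponent x y =
    Semiadj x y ×
    (∀ a b → Semiadj a b → (a ≡ x × b ≡ y) ⊎ (a ≡ y × b ≡ x)) ×
    (∀ w → ¬ (Adj x w × Adj y w))

  LightComponent : Fin n → Fin n → Fin n → Set
  LightComponent v x y =
    Semiadj v x × Semiadj v y × x ≢ y ×
    (∀ a b → Semiadj a b →
        (a ≡ v × b ≡ x) ⊎ (a ≡ x × b ≡ v) ⊎ (a ≡ v × b ≡ y) ⊎ (a ≡ y × b ≡ v)) ×
    (∀ w → w ≢ v → w ≢ x → w ≢ y → StrongAnti v w) ×
    StrongAnti x y ×
    (∀ w → Adj x w → Adj y w → w ≡ v)

  IsGraph : Set
  IsGraph = ∀ u v → ¬ Semiadj u v

  EvenPair : Fin n → Fin n → Set
  EvenPair u v = StrongAnti u v × (∀ k → Path u v k → 2 ∣ k)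

IsBerge : ∀ {n} → Trigraph n → Set
IsBerge T = ¬ HasOddHole T × ¬ HasOddHole (complement T)

InF : ∀ {n} → Trigraph n → Set
InF T = IsBerge T
      × (IsGraph T ⊎ (∃[ x ] ∃[ y ] SmallComponent T x y)
                   ⊎ (∃[ v ] ∃[ x ] ∃[ y ] LightComponent T v x y))

Favorable : ∀ {n} → Trigraph n → Set
Favorable {n} T =
  5 ≤ n ×
  (∃[ u ] ∃[ v ] (StrongAnti T u v × ¬ InD T u × ¬ InD T v)) ×
  (∀ x y → SmallComponent T x y →
     ¬ Rest x ⊎ ¬ Rest y)
  where
    Rest : Fin n → Set
    Rest z = ∀ u w → ¬ InD T u → ¬ InN T z u → ¬ InD T w → ¬ InN T z w →
               u ≢ w → Adj T u w

{-# OPTIONS --safe #-}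
-- If the complement of T is bipartite, T is the union of two strong cliques. A light
-- component is then impossible (x and y both lie opposite v, so they are strongly
-- adjacent), and for a small component xy the non-neighbours of x outside D form a
-- clique, as do those of y, so T is not favorable. If the complement is a line trigraph,
-- a light component is a triangle of the complement containing a switchable pair. For a
-- small component xy, every other vertex is strongly adjacent to exactly one of x, y
-- (both contradicts smallness, neither gives such a triangle), and the line-graph
-- structure of the complement makes the neighbours of x strongly antiadjacent to each
-- other outside D, and likewise for y. So adjacency to x is a proper 2-colouring of T,
-- paths between vertices of equal colour have even length, and among the favorable pair
-- u, v and a fifth vertex outside {x, y, u, v} two vertices have equal colour.
module Submission where

open import Defs
open import Data.Nat using (ℕ)
open import Data.Fin using (Fin)
open import Data.Product using (∃-syntax; _×_)
open import Data.Sum using (_⊎_)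
open import Relation.Nullary using (¬_)

open import Data.Bool using (Bool; true; false; not)
open import Data.Bool.Properties using (not-involutive; not-¬; ¬-not)
  renaming (_≟_ to _≟ᵇ_)
open import Data.Empty using (⊥-elim)
open import Function using (_∘_; id; case_of_)
open import Data.Fin as Fin using (fromℕ<; _≟_; #_)
open import Data.Fin.Properties using (any?; ¬∀⟶∃¬; injective⇒≤; fromℕ-def; toℕ-fromℕ<)
open import Data.Fin.Subset using (Subset; ⁅_⁆; _∪_; ∣_∣; _⊂_; _∈_)
open import Data.Fin.Subset.Properties
  using (x∈⁅x⁆; x∈⁅y⁆⇒x≡y; x∈p∪q⁻; x∈p∪q⁺; p⊂q⇒∣p∣<∣q∣; ∣⁅x⁆∣≡1)
open import Data.Nat using (suc; zero; _<_; _≤_; s≤s)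
open import Data.Nat.Divisibility using (_∣_; _∣0; ∣-refl; ∣m∣n⇒∣m+n)
open import Data.Nat.Properties using (≤-refl; ≤-trans; n<1+n; <⇒≱)
  renaming (<-trans to <ℕ-trans)
open import Data.Product using (∃; _,_; proj₁; proj₂)
open import Data.Sum as Sum using (inj₁; inj₂)
open import Data.Vec using (_∷_; []; lookup)
open import Relation.Binary using (Decidable)
open import Relation.Nullary using (Dec; yes; no; ¬?; _×-dec_; decidable-stable)
open import Relation.Binary.PropositionalEquality
  using (_≡_; _≢_; refl; cong; subst; trans; ≢-sym)
  renaming (sym to ≡-sym)

≡minus? : (a : Val) → Dec (a ≡ minus)
≡minus? plus  = no λ ()
≡minus? semi  = no λ ()
≡minus? minus = yes refl

neg≡minus⇒≡plus : ∀ {a} → neg a ≡ minus → a ≡ plus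
neg≡minus⇒≡plus {plus} _ = refl

Fin2-≢-≢⇒≡ : ∀ {a b c : Fin 2} → a ≢ c → b ≢ c → a ≡ b
Fin2-≢-≢⇒≡ {Fin.zero}         {Fin.zero}         _   _   = refl
Fin2-≢-≢⇒≡ {Fin.suc Fin.zero} {Fin.suc Fin.zero} _   _   = refl
Fin2-≢-≢⇒≡ {Fin.zero}         {Fin.suc Fin.zero} {Fin.zero}         a≢c _   = ⊥-elim (a≢c refl)
Fin2-≢-≢⇒≡ {Fin.zero}         {Fin.suc Fin.zero} {Fin.suc Fin.zero} _   b≢c = ⊥-elim (b≢c refl)
Fin2-≢-≢⇒≡ {Fin.suc Fin.zero} {Fin.zero}         {Fin.zero}         _   b≢c = ⊥-elim (b≢c refl)
Fin2-≢-≢⇒≡ {Fin.suc Fin.zero} {Fin.zero}         {Fin.suc Fin.zero} a≢c _   = ⊥-elim (a≢c refl)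

∃-avoiding : ∀ {k n} → k < n → (f : Fin k → Fin n) → ∃ λ w → ∀ i → f i ≢ w
∃-avoiding {k} {n} k<n f with ¬∀⟶∃¬ n (λ w → ∃ λ i → f i ≡ w) (λ w → any? (λ i → f i ≟ w)) ¬onto
  where
  ¬onto : ¬ (∀ w → ∃ λ i → f i ≡ w)
  ¬onto onto = <⇒≱ k<n (injective⇒≤ {f = λ w → proj₁ (onto w)} λ {w} {w′} eq →
    trans (≡-sym (proj₂ (onto w))) (trans (cong f eq) (proj₂ (onto w′))))
... | w , unhit = w , λ i eq → unhit (i , eq)

module _ {n} (T : Trigraph n) where

  Adj? : Decidable (Adj T)
  Adj? u v = ¬? (u ≟ v) ×-dec ¬? (≡minus? (θ T u v))

  Adj-sym : ∀ {u v} → Adj T u v → Adj T v u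
  Adj-sym {u} {v} (u≢v , uv) = ≢-sym u≢v , λ vu → uv (trans (sym T u v) vu)

  Semiadj-sym : ∀ {u v} → Semiadj T u v → Semiadj T v u
  Semiadj-sym {u} {v} (u≢v , uv) = ≢-sym u≢v , trans (sym T v u) uv

  Semiadj⇒Adj : ∀ {u v} → Semiadj T u v → Adj T u v
  Semiadj⇒Adj (u≢v , uv) = u≢v , λ uv′ → case trans (≡-sym uv) uv′ of λ ()

  Semiadj⇒Anti : ∀ {u v} → Semiadj T u v → Anti T u v
  Semiadj⇒Anti (u≢v , uv) = u≢v , λ uv′ → case trans (≡-sym uv) uv′ of λ ()

  StrongAnti⇒Anti : ∀ {u v} → StrongAnti T u v → Anti T u v
  StrongAnti⇒Anti (u≢v , uv) = u≢v , λ uv′ → case trans (≡-sym uv) uv′ of λ ()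

  ¬Adj⇒StrongAnti : ∀ {u v} → u ≢ v → ¬ Adj T u v → StrongAnti T u v
  ¬Adj⇒StrongAnti {u} {v} u≢v ¬uv =
    u≢v , decidable-stable (≡minus? (θ T u v)) (λ uv → ¬uv (u≢v , uv))

  Adj⇒StrongAdj : ∀ {u v} → ¬ InD T u → Adj T u v → StrongAdj T u v
  Adj⇒StrongAdj {u} {v} u∉D (u≢v , uv) with θ T u v in eq
  ... | plus  = u≢v , refl
  ... | semi  = ⊥-elim (u∉D (v , u≢v , eq))
  ... | minus = ⊥-elim (uv refl)

  StrongAdj-sym : ∀ {u v} → StrongAdj T u v → StrongAdj T v u
  StrongAdj-sym {u} {v} (u≢v , uv) = ≢-sym u≢v , trans (sym T v u) uv

  StrongAdj⇒Adj : ∀ {u v} → StrongAdj T u v → Adj T u v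
  StrongAdj⇒Adj (u≢v , uv) = u≢v , λ uv′ → case trans (≡-sym uv) uv′ of λ ()

  Anti⇒¬Adj : ∀ {u v} → ¬ InD T u → Anti T u v → ¬ Adj T u v
  Anti⇒¬Adj u∉D (_ , uv) uv′ = uv (proj₂ (Adj⇒StrongAdj u∉D uv′))

  Anti⇒Adjᶜ : ∀ {u v} → Anti T u v → Adj (complement T) u v
  Anti⇒Adjᶜ (u≢v , uv) = u≢v , λ uv′ → uv (neg≡minus⇒≡plus uv′)

  Adjᶜ⇒Anti : ∀ {u v} → Adj (complement T) u v → Anti T u v
  Adjᶜ⇒Anti (u≢v , uv) = u≢v , λ uv′ → uv (cong neg uv′)

  ¬Adj⇒Adjᶜ : ∀ {u v} → u ≢ v → ¬ Adj T u v → Adj (complement T) u v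
  ¬Adj⇒Adjᶜ u≢v ¬uv = Anti⇒Adjᶜ (StrongAnti⇒Anti (¬Adj⇒StrongAnti u≢v ¬uv))

  StrongAdj⇒¬Adjᶜ : ∀ {u v} → StrongAdj T u v → ¬ Adj (complement T) u v
  StrongAdj⇒¬Adjᶜ (_ , uv) (_ , uv′) = uv′ (cong neg uv)

  Semiadj⇒¬StrongAdjᶜ : ∀ {u v} → Semiadj T u v → ¬ StrongAdj (complement T) u v
  Semiadj⇒¬StrongAdjᶜ (_ , uv) (_ , uv′) = case trans (cong neg (≡-sym uv)) uv′ of λ ()

ProperColouring : ∀ {n} → Trigraph n → (Fin n → Bool) → Set
ProperColouring T c = ∀ u v → Adj T u v → c u ≢ c v

module _ {n} (T : Trigraph n) {c : Fin n → Bool} (proper : ProperColouring T c) where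

  path-colour-alternates : ∀ {a b k m} (P : Path T a b k) (1+m<1+k : suc m < suc k) →
    c (Path.p P (fromℕ< 1+m<1+k)) ≡ not (c (Path.p P (fromℕ< (<ℕ-trans (n<1+n m) 1+m<1+k))))
  path-colour-alternates {m = m} P 1+m<1+k =
    ¬-not (≢-sym (proper _ _ (Path.consec P _ _ consecutive)))
    where
    consecutive = trans (cong suc (toℕ-fromℕ< (<ℕ-trans (n<1+n m) 1+m<1+k)))
                        (≡-sym (toℕ-fromℕ< 1+m<1+k))

  path-colour : ∀ {a b k} (P : Path T a b k) m (m<1+k : m < suc k) →
    (c (Path.p P (fromℕ< m<1+k)) ≡ c a × 2 ∣ m) ⊎
    (c (Path.p P (fromℕ< m<1+k)) ≡ not (c a) × 2 ∣ suc m)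
  path-colour P zero    _        = inj₁ (cong c (Path.start P) , 2 ∣0)
  path-colour P (suc m) 1+m<1+k with path-colour P m (<ℕ-trans (n<1+n m) 1+m<1+k)
  ... | inj₁ (cm≡ca , 2∣m) =
    inj₂ (trans (path-colour-alternates P 1+m<1+k) (cong not cm≡ca) , ∣m∣n⇒∣m+n ∣-refl 2∣m)
  ... | inj₂ (cm≡¬ca , 2∣1+m) =
    inj₁ (trans (path-colour-alternates P 1+m<1+k) (trans (cong not cm≡¬ca) (not-involutive _)) , 2∣1+m)

  path-even : ∀ {a b k} → c a ≡ c b → Path T a b k → 2 ∣ k
  path-even {a} {b} {k} ca≡cb P with path-colour P k ≤-refl
  ... | inj₁ (_ , 2∣k) = 2∣k
  ... | inj₂ (ck≡¬ca , _) = ⊥-elim (not-¬ refl (trans ca≡cb (trans (cong c b≡pk) ck≡¬ca)))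
    where b≡pk = trans (≡-sym (Path.end P)) (cong (Path.p P) (fromℕ-def k))

  same-colour⇒EvenPair : ∀ {u v} → u ≢ v → c u ≡ c v → EvenPair T u v
  same-colour⇒EvenPair u≢v cu≡cv =
    ¬Adj⇒StrongAnti T u≢v (λ uv → proper _ _ uv cu≡cv) , λ _ → path-even cu≡cv

LargeCliquesStrong : ∀ {n} → Trigraph n → Set
LargeCliquesStrong {n} S = ∀ (X : Subset n) → 3 ≤ ∣ X ∣ → IsCliqueSet S X → IsStrongCliqueSet S X

triangle-strong : ∀ {n} (S : Trigraph n) → LargeCliquesStrong S → ∀ {a b c} →
  a ≢ b → a ≢ c → b ≢ c → Adj S a b → Adj S a c → Adj S b c → StrongAdj S a b
triangle-strong S strong {a} {b} {c} a≢b a≢c b≢c ab ac bc = strong X 3≤∣X∣ clique a b a∈X b∈X a≢b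
  where
  Y = ⁅ b ⁆ ∪ ⁅ c ⁆
  X = ⁅ a ⁆ ∪ Y
  a∈X : a ∈ X
  a∈X = x∈p∪q⁺ (inj₁ (x∈⁅x⁆ a))
  b∈Y : b ∈ Y
  b∈Y = x∈p∪q⁺ (inj₁ (x∈⁅x⁆ b))
  b∈X : b ∈ X
  b∈X = x∈p∪q⁺ (inj₂ b∈Y)
  members-Y : ∀ {u} → u ∈ Y → u ≡ b ⊎ u ≡ c
  members-Y u∈Y = Sum.map (x∈⁅y⁆⇒x≡y b) (x∈⁅y⁆⇒x≡y c) (x∈p∪q⁻ ⁅ b ⁆ ⁅ c ⁆ u∈Y)
  members : ∀ {u} → u ∈ X → u ≡ a ⊎ u ≡ b ⊎ u ≡ c
  members u∈X = Sum.map (x∈⁅y⁆⇒x≡y a) members-Y (x∈p∪q⁻ ⁅ a ⁆ Y u∈X)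
  c⊂Y : ⁅ c ⁆ ⊂ Y
  c⊂Y = (λ u∈c → x∈p∪q⁺ (inj₂ u∈c)) , b , b∈Y , λ b∈c → b≢c (x∈⁅y⁆⇒x≡y c b∈c)
  Y⊂X : Y ⊂ X
  Y⊂X = (λ u∈Y → x∈p∪q⁺ (inj₂ u∈Y)) , a , a∈X , λ a∈Y → Sum.[ a≢b , a≢c ] (members-Y a∈Y)
  3≤∣X∣ : 3 ≤ ∣ X ∣
  3≤∣X∣ = ≤-trans (s≤s (subst (_< ∣ Y ∣) (∣⁅x⁆∣≡1 c) (p⊂q⇒∣p∣<∣q∣ c⊂Y))) (p⊂q⇒∣p∣<∣q∣ Y⊂X)
  clique : IsCliqueSet S X
  clique u v u∈X v∈X u≢v with members u∈X | members v∈X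
  ... | inj₁ refl        | inj₁ refl        = ⊥-elim (u≢v refl)
  ... | inj₁ refl        | inj₂ (inj₁ refl) = ab
  ... | inj₁ refl        | inj₂ (inj₂ refl) = ac
  ... | inj₂ (inj₁ refl) | inj₁ refl        = Adj-sym S ab
  ... | inj₂ (inj₁ refl) | inj₂ (inj₁ refl) = ⊥-elim (u≢v refl)
  ... | inj₂ (inj₁ refl) | inj₂ (inj₂ refl) = bc
  ... | inj₂ (inj₂ refl) | inj₁ refl        = Adj-sym S ac
  ... | inj₂ (inj₂ refl) | inj₂ (inj₁ refl) = Adj-sym S bc
  ... | inj₂ (inj₂ refl) | inj₂ (inj₂ refl) = ⊥-elim (u≢v refl)

-- The edges a and b of the bipartite graph meet q, but not p, so both contain
-- the end of q that p does not.
adjacent-at-far-end : ∀ {n} (S : Trigraph n) → FullRealizationIsLineGraphOfBipartite S →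
  ∀ {p q a b} → p ≢ a → p ≢ b → a ≢ b →
  Adj S p q → Adj S q a → Adj S q b → ¬ Adj S p a → ¬ Adj S p b → Adj S a b
adjacent-at-far-end S (_ , _ , e , _ , line) {p} {q} {a} {b} p≢a p≢b a≢b pq qa qb ¬pa ¬pb
  with shared pq | shared qa | shared qb
  where
  shared : ∀ {u v} → Adj S u v → proj₁ (e u) ≡ proj₁ (e v) ⊎ proj₂ (e u) ≡ proj₂ (e v)
  shared uv = proj₁ (line _ _ (proj₁ uv)) uv
... | inj₁ p₁≡q₁ | inj₁ q₁≡a₁ | _          = ⊥-elim (¬pa (proj₂ (line p a p≢a) (inj₁ (trans p₁≡q₁ q₁≡a₁))))
... | inj₁ p₁≡q₁ | inj₂ _      | inj₁ q₁≡b₁ = ⊥-elim (¬pb (proj₂ (line p b p≢b) (inj₁ (trans p₁≡q₁ q₁≡b₁))))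
... | inj₁ _     | inj₂ q₂≡a₂ | inj₂ q₂≡b₂ = proj₂ (line a b a≢b) (inj₂ (trans (≡-sym q₂≡a₂) q₂≡b₂))
... | inj₂ p₂≡q₂ | inj₂ q₂≡a₂ | _          = ⊥-elim (¬pa (proj₂ (line p a p≢a) (inj₂ (trans p₂≡q₂ q₂≡a₂))))
... | inj₂ p₂≡q₂ | inj₁ _      | inj₂ q₂≡b₂ = ⊥-elim (¬pb (proj₂ (line p b p≢b) (inj₂ (trans p₂≡q₂ q₂≡b₂))))
... | inj₂ _     | inj₁ q₁≡a₁ | inj₁ q₁≡b₁ = proj₂ (line a b a≢b) (inj₁ (trans (≡-sym q₁≡a₁) q₁≡b₁))

module _ {n} (T : Trigraph n) (bipartite : IsBipartite (complement T)) where

  private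
    side : Fin n → Fin 2
    side = proj₁ bipartite

  same-side⇒StrongAdj : ∀ {u v} → u ≢ v → side u ≡ side v → StrongAdj T u v
  same-side⇒StrongAdj u≢v same = u≢v , neg≡minus⇒≡plus (proj₂ (proj₂ bipartite _ _ u≢v same))

  ¬Adj⇒other-side : ∀ {u v} → u ≢ v → ¬ Adj T u v → side u ≢ side v
  ¬Adj⇒other-side u≢v ¬uv same = ¬uv (StrongAdj⇒Adj T (same-side⇒StrongAdj u≢v same))

  Semiadj⇒other-side : ∀ {u v} → Semiadj T u v → side u ≢ side v
  Semiadj⇒other-side (u≢v , uv) same =
    case trans (≡-sym uv) (proj₂ (same-side⇒StrongAdj u≢v same)) of λ ()

  non-neighbours-adjacent : ∀ {z u w} → z ≢ u → ¬ Adj T z u → z ≢ w → ¬ Adj T z w →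
    u ≢ w → Adj T u w
  non-neighbours-adjacent z≢u ¬zu z≢w ¬zw u≢w = StrongAdj⇒Adj T (same-side⇒StrongAdj u≢w
    (Fin2-≢-≢⇒≡ (≢-sym (¬Adj⇒other-side z≢u ¬zu)) (≢-sym (¬Adj⇒other-side z≢w ¬zw))))

  bipartite-small-unfavorable : ∀ {x y} → SmallComponent T x y → ¬ Favorable T
  bipartite-small-unfavorable {x} {y} small (_ , _ , one-side-not-clique) =
    Sum.[ (λ ¬rest → ¬rest (rest (y , xy))) , (λ ¬rest → ¬rest (rest (x , Semiadj-sym T xy))) ]
      (one-side-not-clique x y small)
    where
    xy = proj₁ small
    rest : ∀ {z} → InD T z → ∀ u w → ¬ InD T u → ¬ Adj T z u → ¬ InD T w → ¬ Adj T z w →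
      u ≢ w → Adj T u w
    rest {z} z∈D _ _ u∉D ¬zu w∉D ¬zw = non-neighbours-adjacent (away u∉D) ¬zu (away w∉D) ¬zw
      where
      away : ∀ {t} → ¬ InD T t → z ≢ t
      away t∉D z≡t = t∉D (subst (InD T) z≡t z∈D)

  bipartite-no-light : ∀ {v x y} → ¬ LightComponent T v x y
  bipartite-no-light (vx , vy , _ , _ , _ , (x≢y , xy) , _) =
    case trans (≡-sym xy) (proj₂ (same-side⇒StrongAdj x≢y same-side)) of λ ()
    where
    same-side = Fin2-≢-≢⇒≡ (≢-sym (Semiadj⇒other-side vx)) (≢-sym (Semiadj⇒other-side vy))

line-no-light : ∀ {n} (T : Trigraph n) → LargeCliquesStrong (complement T) →
  ∀ {v x y} → ¬ LightComponent T v x y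
line-no-light T strong (vx , vy , x≢y , _ , _ , xy , _) =
  Semiadj⇒¬StrongAdjᶜ T vx (triangle-strong (complement T) strong (proj₁ vx) (proj₁ vy) x≢y
    (Anti⇒Adjᶜ T (Semiadj⇒Anti T vx)) (Anti⇒Adjᶜ T (Semiadj⇒Anti T vy))
    (Anti⇒Adjᶜ T (StrongAnti⇒Anti T xy)))

module SmallComponentOfLineComplement {n} (T : Trigraph n) {x y : Fin n}
  (small : SmallComponent T x y) (line : IsLineTrigraph (complement T)) where

  private
    xy : Semiadj T x y
    xy = proj₁ small

    disjoint : ∀ w → ¬ (Adj T x w × Adj T y w)
    disjoint = proj₂ (proj₂ small)

  outside-D : ∀ {w} → w ≢ x → w ≢ y → ¬ InD T w
  outside-D w≢x w≢y (_ , wu) = Sum.[ w≢x ∘ proj₁ , w≢y ∘ proj₁ ] (proj₁ (proj₂ small) _ _ wu)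

  x-or-y-adjacent : ∀ {w} → w ≢ x → w ≢ y → Adj T x w ⊎ Adj T y w
  x-or-y-adjacent {w} w≢x w≢y with Adj? T x w | Adj? T y w
  ... | yes xw | _      = inj₁ xw
  ... | no _   | yes yw = inj₂ yw
  ... | no ¬xw | no ¬yw = ⊥-elim (Semiadj⇒¬StrongAdjᶜ T xy
    (triangle-strong (complement T) (proj₂ line) (proj₁ xy) (≢-sym w≢x) (≢-sym w≢y)
      (Anti⇒Adjᶜ T (Semiadj⇒Anti T xy)) (¬Adj⇒Adjᶜ T (≢-sym w≢x) ¬xw)
      (¬Adj⇒Adjᶜ T (≢-sym w≢y) ¬yw)))

  antiadjacent-across : ∀ {p q a b} → Anti T p q → a ≢ b → q ≢ a → q ≢ b →
    StrongAdj T p a → StrongAdj T p b → ¬ Adj T q a → ¬ Adj T q b → Anti T a b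
  antiadjacent-across pq a≢b q≢a q≢b pa pb ¬qa ¬qb = Adjᶜ⇒Anti T
    (adjacent-at-far-end (complement T) (proj₁ line) (proj₁ pa) (proj₁ pb) a≢b
      (Anti⇒Adjᶜ T pq) (¬Adj⇒Adjᶜ T q≢a ¬qa) (¬Adj⇒Adjᶜ T q≢b ¬qb)
      (StrongAdj⇒¬Adjᶜ T pa) (StrongAdj⇒¬Adjᶜ T pb))

  colour : Fin n → Bool
  colour w with Adj? T x w
  ... | yes _ = true
  ... | no _  = false

  x-neighbours-nonadjacent : ∀ {u v} → Adj T x u → Adj T x v → ¬ Adj T u v
  x-neighbours-nonadjacent {u} {v} xu xv uv with u ≟ y | v ≟ y
  ... | yes refl | _        = disjoint v (xv , uv)
  ... | no _     | yes refl = disjoint u (xu , Adj-sym T uv)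
  ... | no u≢y   | no v≢y   = Anti⇒¬Adj T u∉D
    (antiadjacent-across (Semiadj⇒Anti T xy) (proj₁ uv) (≢-sym u≢y) (≢-sym v≢y)
      (StrongAdj-sym T (Adj⇒StrongAdj T u∉D (Adj-sym T xu)))
      (StrongAdj-sym T (Adj⇒StrongAdj T v∉D (Adj-sym T xv)))
      (λ yu → disjoint u (xu , yu)) (λ yv → disjoint v (xv , yv))) uv
    where
    u∉D = outside-D (≢-sym (proj₁ xu)) u≢y
    v∉D = outside-D (≢-sym (proj₁ xv)) v≢y

  x-non-neighbours-nonadjacent : ∀ {u v} → ¬ Adj T x u → ¬ Adj T x v → ¬ Adj T u v
  x-non-neighbours-nonadjacent {u} {v} ¬xu ¬xv uv with u ≟ x | v ≟ x | u ≟ y | v ≟ y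
  ... | yes refl | _        | _        | _        = ¬xv uv
  ... | no _     | yes refl | _        | _        = ¬xu (Adj-sym T uv)
  ... | no _     | no _     | yes refl | _        = ¬xu (Semiadj⇒Adj T xy)
  ... | no _     | no _     | no _     | yes refl = ¬xv (Semiadj⇒Adj T xy)
  ... | no u≢x   | no v≢x   | no u≢y   | no v≢y   = Anti⇒¬Adj T u∉D
    (antiadjacent-across (Semiadj⇒Anti T (Semiadj-sym T xy)) (proj₁ uv) (≢-sym u≢x) (≢-sym v≢x)
      (y-strong u≢x u≢y ¬xu) (y-strong v≢x v≢y ¬xv) ¬xu ¬xv) uv
    where
    u∉D = outside-D u≢x u≢y
    y-strong : ∀ {w} → w ≢ x → w ≢ y → ¬ Adj T x w → StrongAdj T y w
    y-strong w≢x w≢y ¬xw = StrongAdj-sym T (Adj⇒StrongAdj T (outside-D w≢x w≢y)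
      (Adj-sym T (Sum.[ ⊥-elim ∘ ¬xw , id ] (x-or-y-adjacent w≢x w≢y))))

  colour-proper : ProperColouring T colour
  colour-proper u v uv with Adj? T x u | Adj? T x v
  ... | yes _  | no _   = λ ()
  ... | no _   | yes _  = λ ()
  ... | yes xu | yes xv = λ _ → x-neighbours-nonadjacent xu xv uv
  ... | no ¬xu | no ¬xv = λ _ → x-non-neighbours-nonadjacent ¬xu ¬xv uv

  even-pair-outside-D : Favorable T → ∃[ u ] ∃[ v ] (EvenPair T u v × ¬ InD T u × ¬ InD T v)
  even-pair-outside-D (5≤n , (u , v , uv , u∉D , v∉D) , _) with colour u ≟ᵇ colour v
  ... | yes same = u , v , same-colour⇒EvenPair T colour-proper (proj₁ uv) same , u∉D , v∉D
  ... | no differ with ∃-avoiding 5≤n (lookup (x ∷ y ∷ u ∷ v ∷ []))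
  ... | w , avoids with colour w ≟ᵇ colour u
  ...   | yes wu = w , u , same-colour⇒EvenPair T colour-proper (≢-sym (avoids (# 2))) wu ,
                   outside-D (≢-sym (avoids (# 0))) (≢-sym (avoids (# 1))) , u∉D
  ...   | no ¬wu = w , v , same-colour⇒EvenPair T colour-proper (≢-sym (avoids (# 3)))
                     (trans (¬-not ¬wu) (≡-sym (¬-not (≢-sym differ)))) ,
                   outside-D (≢-sym (avoids (# 0))) (≢-sym (avoids (# 1))) , v∉D

proposition4p8 : ∀ {n : ℕ} (T : Trigraph n) → InF T →
    (IsBipartite (complement T) ⊎ IsLineTrigraph (complement T)) →
    Favorable T →
    IsGraph T ⊎ (∃[ u ] ∃[ v ] (EvenPair T u v × ¬ InD T u × ¬ InD T v))
proposition4p8 T (_ , inj₁ graph) _ _ = inj₁ graph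
proposition4p8 T (_ , inj₂ (inj₁ (_ , _ , small))) (inj₁ bipartite) favorable =
  ⊥-elim (bipartite-small-unfavorable T bipartite small favorable)
proposition4p8 T (_ , inj₂ (inj₁ (_ , _ , small))) (inj₂ line) favorable =
  inj₂ (SmallComponentOfLineComplement.even-pair-outside-D T small line favorable)
proposition4p8 T (_ , inj₂ (inj₂ (_ , _ , _ , light))) (inj₁ bipartite) _ =
  ⊥-elim (bipartite-no-light T bipartite light)
proposition4p8 T (_ , inj₂ (inj₂ (_ , _ , _ , light))) (inj₂ line) _ =
  ⊥-elim (line-no-light T (proj₂ line) light)
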